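{- For any integer $n>5$, there is a permutation $\pi$ of $\{1,\ldots,n\}$ such that $\pi(1)=1$, $\pi(n)=n$, and $$\sum_{k=1}^{n-1}\frac{1}{\pi(k)-\pi(k+1)}=0.$$ -}

module Defs where

open import Data.Nat as ℕ using (ℕ; zero; suc; _<_; _<?_; _∸_)
open import Data.Integer as ℤ using (ℤ; +_; -[1+_]; +[1+_])
open import Data.Rational as ℚ using (ℚ; 0ℚ; _+_; -_)
open import Data.Fin using (Fin; toℕ; fromℕ<)
open import Data.Fin.Permutation using (Permutation′; _⟨$⟩ʳ_)
open import Relation.Nullary using (yes; no)

-- Value π(k) of a permutation of {1,…,n}, with π represented as a
-- permutation of Fin n via the shift i ↦ i+1.  Defined for 1 ≤ k ≤ n
-- (returns 0 outside this range; never used there).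
app : (n : ℕ) → Permutation′ n → ℕ → ℕ
app n π zero = 0
app n π (suc k) with k <? n
... | yes k<n = suc (toℕ (π ⟨$⟩ʳ fromℕ< k<n))
... | no  _   = 0

-- 1/d for a nonzero integer d (value 0 at d = 0; that case never occurs
-- for differences of distinct values of a permutation).
recip : ℤ → ℚ
recip (+ zero)   = 0ℚ
recip +[1+ m ]   = (+ 1) ℚ./ suc m
recip -[1+ m ]   = - ((+ 1) ℚ./ suc m)

sumTo : ℕ → (ℕ → ℚ) → ℚ
sumTo zero    f = 0ℚ
sumTo (suc j) f = sumTo j f + f (suc j)

recipSum : (n : ℕ) → Permutation′ n → ℚ
recipSum n π = sumTo (n ∸ 1) (λ k → recip ((+ app n π k) ℤ.- (+ app n π (suc k))))

-- The block 1 3 2 has reciprocal gap sum 1/(1−3) + 1/(3−2) = 1/2.  Placing it in front of a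
-- permutation σ of {1,…,m} with σ(1) = 1, shifted by 3, creates one new gap 1/(2−4) = −1/2, so the
-- three conditions pass from m to m + 3 (gaps are invariant under shifting).  Explicit examples for
-- n = 6, 7, 8 start the induction.
module Submission where

open import Defs
open import Data.Nat using (ℕ; _<_)
open import Data.Product using (Σ; _×_)
open import Data.Rational using (0ℚ)
open import Data.Fin.Permutation using (Permutation′)
open import Relation.Binary.PropositionalEquality using (_≡_)

open import Data.Nat using (zero; suc; _+_; _≤_; z≤n; s≤s; _<?_)
open import Data.Nat.Properties using (+-identityʳ; +-suc; +-comm; <⇒≤; m<n⇒m<1+n; n<1+n)
open import Data.Integer as ℤ using (_⊖_)
open import Data.Integer.Properties using (m-n≡m⊖n; +-cancelˡ-⊖)
open import Data.Rational as ℚ using (ℚ)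
import Data.Rational.Properties as ℚ
open import Data.Fin using (Fin; toℕ; fromℕ<; #_; splitAt; join; _↑ˡ_; _↑ʳ_)
open import Data.Fin.Properties
  using (toℕ<n; toℕ-fromℕ<; fromℕ<-toℕ; toℕ-↑ˡ; toℕ-↑ʳ; splitAt-↑ˡ; splitAt-↑ʳ; splitAt-join; join-splitAt; all?; _≟_)
open import Data.Fin.Permutation
  using (permutation; flip; transpose; _⟨$⟩ʳ_; _⟨$⟩ˡ_; inverseˡ)
open import Data.Sum as Sum using (_⊎_)
open import Data.Sum.Properties using (map-map; map-cong; map-id)
open import Data.Product using (_,_)
open import Data.Vec using (Vec; []; _∷_; lookup)
open import Function using (_∘_)
open import Relation.Binary.PropositionalEquality using (refl; sym; trans; cong; cong₂; module ≡-Reasoning)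
open import Relation.Nullary.Decidable using (True; toWitness)
open import Relation.Nullary using (yes; no)
open import Relation.Nullary.Negation using (contradiction)

private
  variable
    m k : ℕ

sumTo-cong : ∀ j {f g : ℕ → ℚ} → (∀ i → i < j → f (suc i) ≡ g (suc i)) →
             sumTo j f ≡ sumTo j g
sumTo-cong zero    eq = refl
sumTo-cong (suc j) eq =
  cong₂ ℚ._+_ (sumTo-cong j (λ i i<j → eq i (m<n⇒m<1+n i<j))) (eq j (n<1+n j))

sumTo-+ : ∀ a b (f : ℕ → ℚ) → sumTo (a + b) f ≡ sumTo a f ℚ.+ sumTo b (λ i → f (a + i))
sumTo-+ a zero    f = begin
  sumTo (a + 0) f   ≡⟨ cong (λ x → sumTo x f) (+-identityʳ a) ⟩
  sumTo a f         ≡⟨ ℚ.+-identityʳ (sumTo a f) ⟨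
  sumTo a f ℚ.+ 0ℚ  ∎
  where open ≡-Reasoning
sumTo-+ a (suc b) f = begin
  sumTo (a + suc b) f                          ≡⟨ cong (λ x → sumTo x f) (+-suc a b) ⟩
  sumTo (a + b) f ℚ.+ f (suc (a + b))          ≡⟨ cong₂ ℚ._+_ (sumTo-+ a b f) (cong f (sym (+-suc a b))) ⟩
  (sumTo a f ℚ.+ sumTo b g) ℚ.+ f (a + suc b)  ≡⟨ ℚ.+-assoc (sumTo a f) (sumTo b g) (f (a + suc b)) ⟩
  sumTo a f ℚ.+ sumTo (suc b) g                ∎
  where
  open ≡-Reasoning
  g : ℕ → ℚ
  g i = f (a + i)

gapSum : (ℕ → ℕ) → ℕ → ℚ
gapSum v j = sumTo j (λ i → recip (ℤ.+ v i ℤ.- ℤ.+ v (suc i)))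

gapSum-cong : ∀ j {v w : ℕ → ℕ} → (∀ i → i ≤ j → v (suc i) ≡ w (suc i)) →
              gapSum v j ≡ gapSum w j
gapSum-cong j eq = sumTo-cong j (λ i i<j →
  cong₂ (λ x y → recip (ℤ.+ x ℤ.- ℤ.+ y)) (eq i (<⇒≤ i<j)) (eq (suc i) i<j))

gapSum-+ : ∀ a b (v : ℕ → ℕ) → gapSum v (a + b) ≡ gapSum v a ℚ.+ gapSum (λ i → v (a + i)) b
gapSum-+ a b v = trans (sumTo-+ a b _) (cong (gapSum v a ℚ.+_) (sumTo-cong b (λ i _ →
  cong (λ x → recip (ℤ.+ v (a + suc i) ℤ.- ℤ.+ v x)) (sym (+-suc a (suc i))))))

+-cancelˡ-− : ∀ s a b → ℤ.+ (s + a) ℤ.- ℤ.+ (s + b) ≡ ℤ.+ a ℤ.- ℤ.+ b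
+-cancelˡ-− s a b = begin
  ℤ.+ (s + a) ℤ.- ℤ.+ (s + b)  ≡⟨ m-n≡m⊖n (s + a) (s + b) ⟩
  (s + a) ⊖ (s + b)            ≡⟨ +-cancelˡ-⊖ s a b ⟩
  a ⊖ b                        ≡⟨ m-n≡m⊖n a b ⟨
  ℤ.+ a ℤ.- ℤ.+ b              ∎
  where open ≡-Reasoning

gapSum-shift : ∀ s (v : ℕ → ℕ) j → gapSum (λ i → s + v i) j ≡ gapSum v j
gapSum-shift s v j = sumTo-cong j (λ i _ → cong recip (+-cancelˡ-− s (v (suc i)) (v (suc (suc i)))))

app-toℕ : ∀ n (π : Permutation′ n) (i : Fin n) → app n π (suc (toℕ i)) ≡ suc (toℕ (π ⟨$⟩ʳ i))
app-toℕ n π i with toℕ i <? n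
... | yes i<n = cong (λ j → suc (toℕ (π ⟨$⟩ʳ j))) (fromℕ<-toℕ i i<n)
... | no  i≮n = contradiction (toℕ<n i) i≮n

blockwise : Permutation′ m → Permutation′ k → Fin (m + k) → Fin (m + k)
blockwise {m} {k} π ρ i = join m k (Sum.map (π ⟨$⟩ʳ_) (ρ ⟨$⟩ʳ_) (splitAt m i))

blockwise-flip : (π : Permutation′ m) (ρ : Permutation′ k) →
                 ∀ i → blockwise (flip π) (flip ρ) (blockwise π ρ i) ≡ i
blockwise-flip {m} {k} π ρ i = begin
  join m k (Sum.map (π ⟨$⟩ˡ_) (ρ ⟨$⟩ˡ_) (splitAt m (join m k (Sum.map (π ⟨$⟩ʳ_) (ρ ⟨$⟩ʳ_) x))))
    ≡⟨ cong (join m k ∘ Sum.map (π ⟨$⟩ˡ_) (ρ ⟨$⟩ˡ_)) (splitAt-join m k (Sum.map (π ⟨$⟩ʳ_) (ρ ⟨$⟩ʳ_) x)) ⟩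
  join m k (Sum.map (π ⟨$⟩ˡ_) (ρ ⟨$⟩ˡ_) (Sum.map (π ⟨$⟩ʳ_) (ρ ⟨$⟩ʳ_) x))
    ≡⟨ cong (join m k) (map-map x) ⟩
  join m k (Sum.map ((π ⟨$⟩ˡ_) ∘ (π ⟨$⟩ʳ_)) ((ρ ⟨$⟩ˡ_) ∘ (ρ ⟨$⟩ʳ_)) x)
    ≡⟨ cong (join m k) (trans (map-cong (λ _ → inverseˡ π) (λ _ → inverseˡ ρ) x) (map-id x)) ⟩
  join m k x
    ≡⟨ join-splitAt m k i ⟩
  i ∎
  where
  open ≡-Reasoning
  x : Fin m ⊎ Fin k
  x = splitAt m i

_⊕_ : Permutation′ m → Permutation′ k → Permutation′ (m + k)
π ⊕ ρ = permutation (blockwise π ρ) (blockwise (flip π) (flip ρ))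
                    (blockwise-flip (flip π) (flip ρ)) (blockwise-flip π ρ)

⊕-↑ˡ : (π : Permutation′ m) (ρ : Permutation′ k) (i : Fin m) →
       (π ⊕ ρ) ⟨$⟩ʳ (i ↑ˡ k) ≡ (π ⟨$⟩ʳ i) ↑ˡ k
⊕-↑ˡ {m} {k} π ρ i = cong (join m k ∘ Sum.map (π ⟨$⟩ʳ_) (ρ ⟨$⟩ʳ_)) (splitAt-↑ˡ m i k)

⊕-↑ʳ : (π : Permutation′ m) (ρ : Permutation′ k) (i : Fin k) →
       (π ⊕ ρ) ⟨$⟩ʳ (m ↑ʳ i) ≡ m ↑ʳ (ρ ⟨$⟩ʳ i)
⊕-↑ʳ {m} {k} π ρ i = cong (join m k ∘ Sum.map (π ⟨$⟩ʳ_) (ρ ⟨$⟩ʳ_)) (splitAt-↑ʳ m k i)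

app-⊕ˡ : (π : Permutation′ m) (ρ : Permutation′ k) →
         ∀ i → i < m → app (m + k) (π ⊕ ρ) (suc i) ≡ app m π (suc i)
app-⊕ˡ {m} {k} π ρ i i<m = begin
  app (m + k) (π ⊕ ρ) (suc i)                ≡⟨ cong (app (m + k) (π ⊕ ρ) ∘ suc) toℕ-j↑ˡk ⟨
  app (m + k) (π ⊕ ρ) (suc (toℕ (j ↑ˡ k)))  ≡⟨ app-toℕ (m + k) (π ⊕ ρ) (j ↑ˡ k) ⟩
  suc (toℕ ((π ⊕ ρ) ⟨$⟩ʳ (j ↑ˡ k)))        ≡⟨ cong (suc ∘ toℕ) (⊕-↑ˡ π ρ j) ⟩
  suc (toℕ ((π ⟨$⟩ʳ j) ↑ˡ k))              ≡⟨ cong suc (toℕ-↑ˡ (π ⟨$⟩ʳ j) k) ⟩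
  suc (toℕ (π ⟨$⟩ʳ j))                      ≡⟨ app-toℕ m π j ⟨
  app m π (suc (toℕ j))                      ≡⟨ cong (app m π ∘ suc) (toℕ-fromℕ< i<m) ⟩
  app m π (suc i)                            ∎
  where
  open ≡-Reasoning
  j : Fin m
  j = fromℕ< i<m
  toℕ-j↑ˡk : toℕ (j ↑ˡ k) ≡ i
  toℕ-j↑ˡk = trans (toℕ-↑ˡ j k) (toℕ-fromℕ< i<m)

app-⊕ʳ : (π : Permutation′ m) (ρ : Permutation′ k) →
         ∀ i → i < k → app (m + k) (π ⊕ ρ) (m + suc i) ≡ m + app k ρ (suc i)
app-⊕ʳ {m} {k} π ρ i i<k = begin
  app (m + k) (π ⊕ ρ) (m + suc i)            ≡⟨ cong (app (m + k) (π ⊕ ρ)) (trans (+-suc m i) (cong suc (sym toℕ-m↑ʳj))) ⟩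
  app (m + k) (π ⊕ ρ) (suc (toℕ (m ↑ʳ j)))  ≡⟨ app-toℕ (m + k) (π ⊕ ρ) (m ↑ʳ j) ⟩
  suc (toℕ ((π ⊕ ρ) ⟨$⟩ʳ (m ↑ʳ j)))        ≡⟨ cong (suc ∘ toℕ) (⊕-↑ʳ π ρ j) ⟩
  suc (toℕ (m ↑ʳ (ρ ⟨$⟩ʳ j)))              ≡⟨ cong suc (toℕ-↑ʳ m (ρ ⟨$⟩ʳ j)) ⟩
  suc (m + toℕ (ρ ⟨$⟩ʳ j))                  ≡⟨ +-suc m _ ⟨
  m + suc (toℕ (ρ ⟨$⟩ʳ j))                  ≡⟨ cong (m +_) (app-toℕ k ρ j) ⟨
  m + app k ρ (suc (toℕ j))                  ≡⟨ cong (λ x → m + app k ρ (suc x)) (toℕ-fromℕ< i<k) ⟩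
  m + app k ρ (suc i)                        ∎
  where
  open ≡-Reasoning
  j : Fin k
  j = fromℕ< i<k
  toℕ-m↑ʳj : toℕ (m ↑ʳ j) ≡ m + i
  toℕ-m↑ʳj = trans (toℕ-↑ʳ m j) (cong (m +_) (toℕ-fromℕ< i<k))

recipSum-⊕ : ∀ c d (π : Permutation′ (suc c)) (ρ : Permutation′ (suc d)) →
  recipSum (suc c + suc d) (π ⊕ ρ) ≡
    (recipSum (suc c) π ℚ.+ recip (ℤ.+ app (suc c) π (suc c) ℤ.- ℤ.+ (suc c + app (suc d) ρ 1)))
      ℚ.+ recipSum (suc d) ρ
recipSum-⊕ c d π ρ = begin
  gapSum v (c + suc d)                                 ≡⟨ cong (gapSum v) (+-suc c d) ⟩
  gapSum v (suc c + d)                                 ≡⟨ gapSum-+ (suc c) d v ⟩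
  gapSum v (suc c) ℚ.+ gapSum (λ i → v (suc c + i)) d  ≡⟨ cong₂ ℚ._+_ (cong₂ ℚ._+_ left junction) right ⟩
  _                                                    ∎
  where
  open ≡-Reasoning
  v : ℕ → ℕ
  v = app (suc c + suc d) (π ⊕ ρ)
  left : gapSum v c ≡ recipSum (suc c) π
  left = gapSum-cong c {v = v} {w = app (suc c) π} (λ i i≤c → app-⊕ˡ π ρ i (s≤s i≤c))
  junction : recip (ℤ.+ v (suc c) ℤ.- ℤ.+ v (suc (suc c))) ≡
             recip (ℤ.+ app (suc c) π (suc c) ℤ.- ℤ.+ (suc c + app (suc d) ρ 1))
  junction = cong₂ (λ x y → recip (ℤ.+ x ℤ.- ℤ.+ y))
    (app-⊕ˡ π ρ c (n<1+n c))
    (trans (cong (v ∘ suc) (+-comm 1 c)) (app-⊕ʳ π ρ 0 (s≤s z≤n)))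
  right : gapSum (λ i → v (suc c + i)) d ≡ recipSum (suc d) ρ
  right = trans (gapSum-cong d {v = λ i → v (suc c + i)} {w = λ i → suc c + app (suc d) ρ i}
                              (λ i i≤d → app-⊕ʳ π ρ i (s≤s i≤d)))
                (gapSum-shift (suc c) (app (suc d) ρ) d)

fromTables : ∀ {n} (f g : Vec (Fin n) n) →
  {True (all? λ i → lookup f (lookup g i) ≟ i)} →
  {True (all? λ i → lookup g (lookup f i) ≟ i)} →
  Permutation′ n
fromTables f g {fg} {gf} = permutation (lookup f) (lookup g) (toWitness fg) (toWitness gf)

Balanced : (n : ℕ) → Permutation′ n → Set
Balanced n π = (app n π 1 ≡ 1) × (app n π n ≡ n) × (recipSum n π ≡ 0ℚ)

-- The tables list π(k) − 1 and π⁻¹(k) − 1; in one-line notation the examples are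
-- 1 4 2 5 3 6,  1 3 2 4 6 5 7  and  1 3 6 4 7 5 2 8.
balanced₆ : Σ (Permutation′ 6) (Balanced 6)
balanced₆ = fromTables (# 0 ∷ # 3 ∷ # 1 ∷ # 4 ∷ # 2 ∷ # 5 ∷ [])
                       (# 0 ∷ # 2 ∷ # 4 ∷ # 1 ∷ # 3 ∷ # 5 ∷ [])
          , refl , refl , refl

balanced₇ : Σ (Permutation′ 7) (Balanced 7)
balanced₇ = fromTables (# 0 ∷ # 2 ∷ # 1 ∷ # 3 ∷ # 5 ∷ # 4 ∷ # 6 ∷ [])
                       (# 0 ∷ # 2 ∷ # 1 ∷ # 3 ∷ # 5 ∷ # 4 ∷ # 6 ∷ [])
          , refl , refl , refl

balanced₈ : Σ (Permutation′ 8) (Balanced 8)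
balanced₈ = fromTables (# 0 ∷ # 2 ∷ # 5 ∷ # 3 ∷ # 6 ∷ # 4 ∷ # 1 ∷ # 7 ∷ [])
                       (# 0 ∷ # 6 ∷ # 1 ∷ # 3 ∷ # 5 ∷ # 2 ∷ # 4 ∷ # 7 ∷ [])
          , refl , refl , refl

transpose₂₃ : Permutation′ 3
transpose₂₃ = transpose (# 1) (# 2)

balanced-+3 : ∀ c (π : Permutation′ (suc c)) → Balanced (suc c) π →
              Balanced (3 + suc c) (transpose₂₃ ⊕ π)
balanced-+3 c π (first , last , sum) =
    app-⊕ˡ transpose₂₃ π 0 (s≤s z≤n)
  , trans (app-⊕ʳ transpose₂₃ π c (n<1+n c)) (cong (3 +_) last)
  , (begin
      recipSum (3 + suc c) (transpose₂₃ ⊕ π)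
        ≡⟨ recipSum-⊕ 2 c transpose₂₃ π ⟩
      (recipSum 3 transpose₂₃ ℚ.+ recip (ℤ.+ 2 ℤ.- ℤ.+ (3 + app (suc c) π 1))) ℚ.+ recipSum (suc c) π
        ≡⟨ cong₂ (λ x y → (recipSum 3 transpose₂₃ ℚ.+ recip (ℤ.+ 2 ℤ.- ℤ.+ (3 + x))) ℚ.+ y) first sum ⟩
      0ℚ ∎)
  where open ≡-Reasoning

balancedFrom₆ : ∀ k → Σ (Permutation′ (6 + k)) (Balanced (6 + k))
balancedFrom₆ 0 = balanced₆
balancedFrom₆ 1 = balanced₇
balancedFrom₆ 2 = balanced₈
balancedFrom₆ (suc (suc (suc k))) with balancedFrom₆ k
... | π , balanced = transpose₂₃ ⊕ π , balanced-+3 (5 + k) π balanced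

proposition1 : (n : ℕ) → 5 < n →
    Σ (Permutation′ n) (λ π → (app n π 1 ≡ 1) × (app n π n ≡ n) × (recipSum n π ≡ 0ℚ))
proposition1 _ (s≤s (s≤s (s≤s (s≤s (s≤s (s≤s {n = k} z≤n)))))) = balancedFrom₆ k
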